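{- For every integer $n\ge1$, $$\sum_{k=\lceil (n-1)/2\rceil}^{\infty}\binom{k}{n-1}_{2}\frac{1}{2^{k+1}}=F_n,$$ where $\binom{k}{j}_{2}=[t^j](1+t+t^2)^k$ are the trinomial coefficients and $F_n$ is the $n$-th Fibonacci number ($F_1=F_2=1$, $F_{n+1}=F_n+F_{n-1}$).
   Context: $[t^j]F(t)$ denotes the coefficient of $t^j$ in the polynomial $F(t)$. -}

module Defs where

open import Data.Nat using (ℕ; zero; suc; _+_; _*_; _^_)
open import Data.Nat.Properties using (m^n≢0)
open import Data.List using (List; []; _∷_)
open import Data.Integer using (+_)
open import Data.Rational using (ℚ; 0ℚ; _/_) renaming (_+_ to _+ℚ_)

-- Polynomials with ℕ coefficients, as coefficient lists (constant term first).
Poly : Set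
Poly = List ℕ

_⊕_ : Poly → Poly → Poly
[] ⊕ q = q
(a ∷ p) ⊕ [] = a ∷ p
(a ∷ p) ⊕ (b ∷ q) = (a + b) ∷ (p ⊕ q)

scale : ℕ → Poly → Poly
scale c [] = []
scale c (a ∷ p) = (c * a) ∷ scale c p

_⊗_ : Poly → Poly → Poly
[] ⊗ q = []
(a ∷ p) ⊗ q = scale a q ⊕ (0 ∷ (p ⊗ q))

_^ᴾ_ : Poly → ℕ → Poly
p ^ᴾ zero = 1 ∷ []
p ^ᴾ suc k = p ⊗ (p ^ᴾ k)

coeff : ℕ → Poly → ℕ
coeff j [] = 0
coeff zero (a ∷ p) = a
coeff (suc j) (a ∷ p) = coeff j p

trinom : Poly
trinom = 1 ∷ 1 ∷ 1 ∷ []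

trinomial : ℕ → ℕ → ℕ
trinomial k j = coeff j (trinom ^ᴾ k)

fib : ℕ → ℕ
fib zero = 0
fib (suc zero) = 1
fib (suc (suc n)) = fib (suc n) + fib n

term : ℕ → ℕ → ℚ
term j k = (+ trinomial k j) / (2 ^ suc k)
  where instance _ = m^n≢0 2 (suc k)

sumRange : (ℕ → ℚ) → ℕ → ℕ → ℚ
sumRange f L zero = 0ℚ
sumRange f L (suc c) = f L +ℚ sumRange f (suc L) c

module Submission where

open import Defs
open import Data.Nat using (ℕ; _≤_; _∸_; ⌈_/2⌉)
open import Data.Product using (∃-syntax)
open import Data.Integer using (+_)
open import Data.Rational using (ℚ; 0ℚ; _<_; _-_; ∣_∣; _/_)

open import Data.Nat using (zero; suc; _+_; _*_; _^_; ⌊_/2⌋; NonZero; z≤n; s≤s; s≤s⁻¹)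
  renaming (_<_ to _<ℕ_)
open import Data.Nat.Properties
open import Data.Nat.Tactic.RingSolver using (solve-∀)
open import Data.List using ([]; _∷_)
open import Data.Product using (_,_)
open import Data.Integer as ℤ using (+[1+_])
import Data.Integer.Properties as ℤP
open import Data.Integer.Tactic.RingSolver as ℤSolver using ()
open import Data.Rational as ℚ using (mkℚ; -_; toℚᵘ; ↧ₙ_; Positive; positive)
open import Data.Rational.Properties as ℚP
  using (toℚᵘ-injective; toℚᵘ-fromℚᵘ; toℚᵘ-homo-+; toℚᵘ-cancel-<)
open import Data.Rational.Unnormalised as ℚᵘ using (mkℚᵘ; _≃_; *≡*; *<*)
import Data.Rational.Unnormalised.Properties as ℚᵘP
open import Relation.Binary.PropositionalEquality

-- Let T c j = [t^j] (1 + t + t²)^c and let E c j = [t^j] (1 + t + t²)^c / (1 - t - t²),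
-- computed by the Fibonacci-like recurrence E c j = T c j + E c (j-1) + E c (j-2).
-- Then E (c+1) = (1 + t + t²) E c, so  2 E c - E (c+1) = (1 - t - t²) E c = T c,  i.e.
--     T c j / 2^(c+1)  =  E c j / 2^c  -  E (c+1) j / 2^(c+1).
-- Hence the series telescopes: a partial sum from k = L with c terms equals
-- E L j / 2^L - E (L+c) j / 2^(L+c).  Because T c j = 0 for 2c < j, the numbers
-- E k j are doubled at each step while 2k ≤ j + 1, so E L j / 2^L = E 0 j = F (j+1)
-- for L = ⌈ j/2 ⌉.  Finally the tail E c j / 2^c tends to 0: evaluating at t = 1/2
-- gives T c j ≤ 2^j (7/4)^c, hence E c j / 2^c ≤ tailBound j · (7/8)^c, and a
-- Bernoulli-type inequality makes (7/8)^c as small as needed.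

coeff-⊕ : ∀ j p q → coeff j (p ⊕ q) ≡ coeff j p + coeff j q
coeff-⊕ j [] q = refl
coeff-⊕ zero (a ∷ p) [] = sym (+-identityʳ a)
coeff-⊕ (suc j) (a ∷ p) [] = sym (+-identityʳ _)
coeff-⊕ zero (a ∷ p) (b ∷ q) = refl
coeff-⊕ (suc j) (a ∷ p) (b ∷ q) = coeff-⊕ j p q

coeff-scale : ∀ j a p → coeff j (scale a p) ≡ a * coeff j p
coeff-scale j a [] = sym (*-zeroʳ a)
coeff-scale zero a (b ∷ p) = refl
coeff-scale (suc j) a (b ∷ p) = coeff-scale j a p

coeff-1∷⊗ : ∀ j p q → coeff j ((1 ∷ p) ⊗ q) ≡ coeff j q + coeff j (0 ∷ (p ⊗ q))
coeff-1∷⊗ j p q = trans (coeff-⊕ j (scale 1 q) _) (cong (_+ coeff j (0 ∷ (p ⊗ q))) (trans (coeff-scale j 1 q) (*-identityˡ _)))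

coeff-0∷[] : ∀ j → coeff j (0 ∷ []) ≡ 0
coeff-0∷[] zero = refl
coeff-0∷[] (suc j) = refl

coeff-1+t⊗ : ∀ j q → coeff (suc j) ((1 ∷ 1 ∷ []) ⊗ q) ≡ coeff (suc j) q + coeff j q
coeff-1+t⊗ j q = begin
  coeff (suc j) ((1 ∷ 1 ∷ []) ⊗ q)
    ≡⟨ coeff-1∷⊗ (suc j) (1 ∷ []) q ⟩
  coeff (suc j) q + coeff j ((1 ∷ []) ⊗ q)
    ≡⟨ cong (_+_ (coeff (suc j) q)) (coeff-1∷⊗ j [] q) ⟩
  coeff (suc j) q + (coeff j q + coeff j (0 ∷ []))
    ≡⟨ cong (λ x → coeff (suc j) q + (coeff j q + x)) (coeff-0∷[] j) ⟩
  coeff (suc j) q + (coeff j q + 0)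
    ≡⟨ cong (_+_ (coeff (suc j) q)) (+-identityʳ (coeff j q)) ⟩
  coeff (suc j) q + coeff j q ∎
  where open ≡-Reasoning

trinomial-rec₀ : ∀ c → trinomial (suc c) 0 ≡ trinomial c 0
trinomial-rec₀ c = trans (coeff-1∷⊗ 0 (1 ∷ 1 ∷ []) (trinom ^ᴾ c)) (+-identityʳ _)

trinomial-rec₁ : ∀ c → trinomial (suc c) 1 ≡ trinomial c 1 + trinomial c 0
trinomial-rec₁ c = trans (coeff-1∷⊗ 1 (1 ∷ 1 ∷ []) P)
  (cong (_+_ (coeff 1 P)) (trans (coeff-1∷⊗ 0 (1 ∷ []) P) (+-identityʳ _)))
  where
  P : Poly
  P = trinom ^ᴾ c

trinomial-rec₂ : ∀ c j → trinomial (suc c) (suc (suc j))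
                          ≡ trinomial c (suc (suc j)) + trinomial c (suc j) + trinomial c j
trinomial-rec₂ c j = trans (coeff-1∷⊗ (suc (suc j)) (1 ∷ 1 ∷ []) P)
  (trans (cong (_+_ (coeff (suc (suc j)) P)) (coeff-1+t⊗ j P))
         (sym (+-assoc (coeff (suc (suc j)) P) (coeff (suc j) P) (coeff j P))))
  where
  P : Poly
  P = trinom ^ᴾ c

double-suc-≤ : ∀ k n → 2 * suc k ≤ suc n → 2 * k <ℕ n
double-suc-≤ k n h = s≤s⁻¹ (subst (_≤ suc n) (*-suc 2 k) h)

trinomial-vanishes : ∀ c j → 2 * c <ℕ j → trinomial c j ≡ 0
trinomial-vanishes zero (suc j) _ = refl
trinomial-vanishes (suc c) (suc zero) (s≤s ())
trinomial-vanishes (suc c) (suc (suc j)) h =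
  trans (trinomial-rec₂ c j) (cong₂ _+_ (cong₂ _+_ (vanish (suc (suc j)) (m<n⇒m<1+n 2c<1+j)) (vanish (suc j) 2c<1+j)) (vanish j 2c<j))
  where
  vanish : ∀ i → 2 * c <ℕ i → trinomial c i ≡ 0
  vanish = trinomial-vanishes c
  2c<j : 2 * c <ℕ j
  2c<j = double-suc-≤ c j (s≤s⁻¹ h)
  2c<1+j : 2 * c <ℕ suc j
  2c<1+j = m<n⇒m<1+n 2c<j

-- Tail numerators: tailNum c j = [t^j] (1 + t + t²)^c / (1 - t - t²).  The value
-- tailNum c j / 2^c will be the tail  Σ_{k ≥ c} T k j / 2^(k+1)  of the series.
tailNum : ℕ → ℕ → ℕ
tailNum c zero = trinomial c 0
tailNum c (suc zero) = trinomial c 1 + tailNum c 0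
tailNum c (suc (suc j)) = trinomial c (suc (suc j)) + tailNum c (suc j) + tailNum c j

-- For c = 0 the numerator series is 1 / (1 - t - t²), whose coefficients are Fibonacci numbers.
tailNum-zero : ∀ j → tailNum 0 j ≡ fib (suc j)
tailNum-zero zero = refl
tailNum-zero (suc zero) = refl
tailNum-zero (suc (suc j)) = cong₂ _+_ (tailNum-zero (suc j)) (tailNum-zero j)

tailNum-step : ∀ c j → tailNum (suc c) j + trinomial c j ≡ 2 * tailNum c j
tailNum-step c zero rewrite trinomial-rec₀ c = double (trinomial c 0)
  where
  double : ∀ a → a + a ≡ 2 * a
  double = solve-∀
tailNum-step c (suc zero) rewrite trinomial-rec₀ c | trinomial-rec₁ c = rearrange (trinomial c 1) (trinomial c 0)
  where
  rearrange : ∀ a b → a + b + b + a ≡ 2 * (a + b)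
  rearrange = solve-∀
tailNum-step c (suc (suc j)) = begin
  T′ (suc (suc j)) + E′ (suc j) + E′ j + T (suc (suc j))
    ≡⟨ cong (λ x → x + E′ (suc j) + E′ j + T (suc (suc j))) (trinomial-rec₂ c j) ⟩
  T (suc (suc j)) + T (suc j) + T j + E′ (suc j) + E′ j + T (suc (suc j))
    ≡⟨ regroup (T (suc (suc j))) (T (suc j)) (T j) (E′ (suc j)) (E′ j) ⟩
  2 * T (suc (suc j)) + (E′ (suc j) + T (suc j)) + (E′ j + T j)
    ≡⟨ cong₂ (λ x y → 2 * T (suc (suc j)) + x + y) (tailNum-step c (suc j)) (tailNum-step c j) ⟩
  2 * T (suc (suc j)) + 2 * E (suc j) + 2 * E j
    ≡⟨ factor (T (suc (suc j))) (E (suc j)) (E j) ⟩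
  2 * (T (suc (suc j)) + E (suc j) + E j) ∎
  where
  open ≡-Reasoning
  T T′ E E′ : ℕ → ℕ
  T = trinomial c
  T′ = trinomial (suc c)
  E = tailNum c
  E′ = tailNum (suc c)
  regroup : ∀ a b d x y → a + b + d + x + y + a ≡ 2 * a + (x + b) + (y + d)
  regroup = solve-∀
  factor : ∀ a x y → 2 * a + 2 * x + 2 * y ≡ 2 * (a + x + y)
  factor = solve-∀

-- While 2k ≤ j + 1 the trinomial terms vanish, so the numerators just double.
tailNum-initial : ∀ k j → 2 * k ≤ suc j → tailNum k j ≡ 2 ^ k * fib (suc j)
tailNum-initial zero j _ = trans (tailNum-zero j) (sym (+-identityʳ _))
tailNum-initial (suc k) j h = begin
  tailNum (suc k) j                 ≡⟨ sym (+-identityʳ _) ⟩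
  tailNum (suc k) j + 0             ≡⟨ cong (_+_ (tailNum (suc k) j)) (sym (trinomial-vanishes k j 2k<j)) ⟩
  tailNum (suc k) j + trinomial k j ≡⟨ tailNum-step k j ⟩
  2 * tailNum k j                   ≡⟨ cong (2 *_) (tailNum-initial k j (m≤n⇒m≤1+n (<⇒≤ 2k<j))) ⟩
  2 * (2 ^ k * fib (suc j))         ≡⟨ sym (*-assoc 2 (2 ^ k) _) ⟩
  2 ^ suc k * fib (suc j)           ∎
  where
  open ≡-Reasoning
  2k<j : 2 * k <ℕ j
  2k<j = double-suc-≤ k j h

-- 2 ⌊n/2⌋ ≤ n; used with n = j + 1, for which ⌊(j+1)/2⌋ = ⌈j/2⌉.
double-half≤ : ∀ n → 2 * ⌊ n /2⌋ ≤ n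
double-half≤ zero = z≤n
double-half≤ (suc zero) = z≤n
double-half≤ (suc (suc n)) = subst (_≤ suc (suc n)) (sym (*-suc 2 ⌊ n /2⌋)) (s≤s (s≤s (double-half≤ n)))

-- Evaluating (1 + t + t²)^c at t = 1/2 gives (7/4)^c, which bounds each term:
-- T c j ≤ 2^j (7/4)^c.
trinomial-bound : ∀ c j → 4 ^ c * trinomial c j ≤ 2 ^ j * 7 ^ c
trinomial-bound zero zero = ≤-refl
trinomial-bound zero (suc j) = z≤n
trinomial-bound (suc c) zero rewrite trinomial-rec₀ c = begin
  4 * 4 ^ c * trinomial c 0   ≡⟨ *-assoc 4 (4 ^ c) _ ⟩
  4 * (4 ^ c * trinomial c 0) ≤⟨ *-monoʳ-≤ 4 (trinomial-bound c 0) ⟩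
  4 * (1 * 7 ^ c)             ≤⟨ *-monoˡ-≤ (1 * 7 ^ c) {4} {7} (s≤s (s≤s (s≤s (s≤s z≤n)))) ⟩
  7 * (1 * 7 ^ c)             ≡⟨ reorder (7 ^ c) ⟩
  1 * (7 * 7 ^ c)             ∎
  where
  open ≤-Reasoning
  reorder : ∀ y → 7 * (1 * y) ≡ 1 * (7 * y)
  reorder = solve-∀
trinomial-bound (suc c) (suc zero) rewrite trinomial-rec₁ c = begin
  4 * 4 ^ c * (trinomial c 1 + trinomial c 0)                 ≡⟨ distrib (4 ^ c) (trinomial c 1) (trinomial c 0) ⟩
  4 * (4 ^ c * trinomial c 1) + 4 * (4 ^ c * trinomial c 0)
    ≤⟨ +-mono-≤ (*-monoʳ-≤ 4 (trinomial-bound c 1)) (*-monoʳ-≤ 4 (trinomial-bound c 0)) ⟩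
  4 * (2 * 7 ^ c) + 4 * (1 * 7 ^ c)                           ≡⟨ collect (7 ^ c) ⟩
  12 * 7 ^ c                                                  ≤⟨ m≤m+n (12 * 7 ^ c) (2 * 7 ^ c) ⟩
  12 * 7 ^ c + 2 * 7 ^ c                                      ≡⟨ collect′ (7 ^ c) ⟩
  2 * (7 * 7 ^ c)                                             ∎
  where
  open ≤-Reasoning
  distrib : ∀ z a b → 4 * z * (a + b) ≡ 4 * (z * a) + 4 * (z * b)
  distrib = solve-∀
  collect : ∀ y → 4 * (2 * y) + 4 * (1 * y) ≡ 12 * y
  collect = solve-∀
  collect′ : ∀ y → 12 * y + 2 * y ≡ 2 * (7 * y)
  collect′ = solve-∀
trinomial-bound (suc c) (suc (suc j)) rewrite trinomial-rec₂ c j = begin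
  4 * 4 ^ c * (T (suc (suc j)) + T (suc j) + T j)
    ≡⟨ distrib (4 ^ c) (T (suc (suc j))) (T (suc j)) (T j) ⟩
  4 * (4 ^ c * T (suc (suc j))) + 4 * (4 ^ c * T (suc j)) + 4 * (4 ^ c * T j)
    ≤⟨ +-mono-≤ (+-mono-≤ (*-monoʳ-≤ 4 (trinomial-bound c (suc (suc j)))) (*-monoʳ-≤ 4 (trinomial-bound c (suc j))))
                (*-monoʳ-≤ 4 (trinomial-bound c j)) ⟩
  4 * (2 ^ suc (suc j) * 7 ^ c) + 4 * (2 ^ suc j * 7 ^ c) + 4 * (2 ^ j * 7 ^ c)
    ≡⟨ collect (2 ^ j) (7 ^ c) ⟩
  2 ^ suc (suc j) * (7 * 7 ^ c) ∎
  where
  open ≤-Reasoning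
  T : ℕ → ℕ
  T = trinomial c
  distrib : ∀ z a b d → 4 * z * (a + b + d) ≡ 4 * (z * a) + 4 * (z * b) + 4 * (z * d)
  distrib = solve-∀
  collect : ∀ x y → 4 * ((2 * (2 * x)) * y) + 4 * ((2 * x) * y) + 4 * (x * y) ≡ (2 * (2 * x)) * (7 * y)
  collect = solve-∀

-- tailBound j follows the recurrence of tailNum with T c j replaced by its bound 2^j.
tailBound : ℕ → ℕ
tailBound zero = 1
tailBound (suc zero) = 3
tailBound (suc (suc j)) = 2 ^ suc (suc j) + tailBound (suc j) + tailBound j

tailNum-bound : ∀ c j → 4 ^ c * tailNum c j ≤ tailBound j * 7 ^ c
tailNum-bound c zero = trinomial-bound c 0
tailNum-bound c (suc zero) = begin
  4 ^ c * (trinomial c 1 + trinomial c 0)         ≡⟨ *-distribˡ-+ (4 ^ c) (trinomial c 1) (trinomial c 0) ⟩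
  4 ^ c * trinomial c 1 + 4 ^ c * trinomial c 0   ≤⟨ +-mono-≤ (trinomial-bound c 1) (trinomial-bound c 0) ⟩
  2 * 7 ^ c + 1 * 7 ^ c                           ≡⟨ collect (7 ^ c) ⟩
  3 * 7 ^ c                                       ∎
  where
  open ≤-Reasoning
  collect : ∀ y → 2 * y + 1 * y ≡ 3 * y
  collect = solve-∀
tailNum-bound c (suc (suc j)) = begin
  4 ^ c * (trinomial c (suc (suc j)) + E (suc j) + E j)
    ≡⟨ distrib (4 ^ c) (trinomial c (suc (suc j))) (E (suc j)) (E j) ⟩
  4 ^ c * trinomial c (suc (suc j)) + 4 ^ c * E (suc j) + 4 ^ c * E j
    ≤⟨ +-mono-≤ (+-mono-≤ (trinomial-bound c (suc (suc j))) (tailNum-bound c (suc j))) (tailNum-bound c j) ⟩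
  2 ^ suc (suc j) * 7 ^ c + tailBound (suc j) * 7 ^ c + tailBound j * 7 ^ c
    ≡⟨ collect (2 ^ suc (suc j)) (tailBound (suc j)) (tailBound j) (7 ^ c) ⟩
  tailBound (suc (suc j)) * 7 ^ c ∎
  where
  open ≤-Reasoning
  E : ℕ → ℕ
  E = tailNum c
  distrib : ∀ z a b d → z * (a + b + d) ≡ z * a + z * b + z * d
  distrib = solve-∀
  collect : ∀ a b d y → a * y + b * y + d * y ≡ (a + b + d) * y
  collect = solve-∀

-- Bernoulli's inequality (1 + 1/7)^n ≥ 1 + n/7, cleared of denominators.
bernoulli : ∀ n → 7 ^ n * (7 + n) ≤ 7 * 8 ^ n
bernoulli zero = ≤-refl
bernoulli (suc n) = begin
  7 * 7 ^ n * (7 + suc n)         ≡⟨ expand (7 ^ n) n ⟩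
  7 ^ n * 56 + 7 * (7 ^ n * n)    ≤⟨ +-monoʳ-≤ (7 ^ n * 56) (*-monoˡ-≤ (7 ^ n * n) (n≤1+n 7)) ⟩
  7 ^ n * 56 + 8 * (7 ^ n * n)    ≡⟨ factor (7 ^ n) n ⟩
  8 * (7 ^ n * (7 + n))           ≤⟨ *-monoʳ-≤ 8 (bernoulli n) ⟩
  8 * (7 * 8 ^ n)                 ≡⟨ *-comm 8 (7 * 8 ^ n) ⟩
  7 * 8 ^ n * 8                   ≡⟨ *-assoc 7 (8 ^ n) 8 ⟩
  7 * (8 ^ n * 8)                 ≡⟨ cong (7 *_) (*-comm (8 ^ n) 8) ⟩
  7 * (8 * 8 ^ n)                 ∎
  where
  open ≤-Reasoning
  expand : ∀ y n → 7 * y * (7 + suc n) ≡ y * 56 + 7 * (y * n)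
  expand = solve-∀
  factor : ∀ y n → y * 56 + 8 * (y * n) ≡ 8 * (y * (7 + n))
  factor = solve-∀

geometric-beats-constant : ∀ K n → 7 * K ≤ n → K * 7 ^ n <ℕ 8 ^ n
geometric-beats-constant K n h = *-cancelˡ-< 7 _ _ (begin-strict
  7 * (K * 7 ^ n)      ≡⟨ sym (*-assoc 7 K (7 ^ n)) ⟩
  7 * K * 7 ^ n        ≤⟨ *-monoˡ-≤ (7 ^ n) h ⟩
  n * 7 ^ n            <⟨ m<m+n (n * 7 ^ n) (*-monoʳ-< 7 (m^n>0 7 n)) ⟩
  n * 7 ^ n + 7 * 7 ^ n ≡⟨ collect (7 ^ n) n ⟩
  7 ^ n * (7 + n)      ≤⟨ bernoulli n ⟩
  7 * 8 ^ n            ∎)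
  where
  open ≤-Reasoning
  collect : ∀ y n → n * y + 7 * y ≡ y * (7 + n)
  collect = solve-∀

8^n≡4^n*2^n : ∀ n → 8 ^ n ≡ 4 ^ n * 2 ^ n
8^n≡4^n*2^n zero = refl
8^n≡4^n*2^n (suc n) = trans (cong (8 *_) (8^n≡4^n*2^n n)) (regroup (4 ^ n) (2 ^ n))
  where
  regroup : ∀ a b → 8 * (a * b) ≡ 4 * a * (2 * b)
  regroup = solve-∀

tailNum-small : ∀ K j c → 7 * (K * tailBound j) ≤ c → K * tailNum c j <ℕ 2 ^ c
tailNum-small K j c h = *-cancelˡ-< (4 ^ c) _ _ (begin-strict
  4 ^ c * (K * tailNum c j) ≡⟨ *-comm-middle (4 ^ c) K (tailNum c j) ⟩
  K * (4 ^ c * tailNum c j) ≤⟨ *-monoʳ-≤ K (tailNum-bound c j) ⟩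
  K * (tailBound j * 7 ^ c) ≡⟨ sym (*-assoc K (tailBound j) (7 ^ c)) ⟩
  K * tailBound j * 7 ^ c   <⟨ geometric-beats-constant (K * tailBound j) c h ⟩
  8 ^ c                     ≡⟨ 8^n≡4^n*2^n c ⟩
  4 ^ c * 2 ^ c             ∎)
  where
  open ≤-Reasoning
  *-comm-middle : ∀ a b d → a * (b * d) ≡ b * (a * d)
  *-comm-middle = solve-∀

-- Fractions  a / m  with natural numerator are normalised; as unnormalised rationals
-- they are literally  a / m,  which is where equalities and inequalities are checked.
toℚᵘ-/ : ∀ a m .{{_ : NonZero m}} → toℚᵘ ((+ a) / m) ≃ (+ a) ℚᵘ./ m
toℚᵘ-/ a (suc d) = toℚᵘ-fromℚᵘ (mkℚᵘ (+ a) d)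

/-cross : ∀ a b m n .{{_ : NonZero m}} .{{_ : NonZero n}} → a * n ≡ b * m → (+ a) / m ≡ (+ b) / n
/-cross a b m@(suc _) n@(suc _) eq = toℚᵘ-injective
  (ℚᵘP.≃-trans (toℚᵘ-/ a m) (ℚᵘP.≃-trans cross (ℚᵘP.≃-sym (toℚᵘ-/ b n))))
  where
  cross : (+ a) ℚᵘ./ m ≃ (+ b) ℚᵘ./ n
  cross = *≡* (trans (sym (ℤP.pos-* a n)) (trans (cong +_ eq) (ℤP.pos-* b m)))

/-+ : ∀ a b m .{{_ : NonZero m}} → (+ a) / m ℚ.+ (+ b) / m ≡ (+ (a + b)) / m
/-+ a b m@(suc _) = toℚᵘ-injective (ℚᵘP.≃-trans (toℚᵘ-homo-+ ((+ a) / m) ((+ b) / m))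
  (ℚᵘP.≃-trans (ℚᵘP.+-cong (toℚᵘ-/ a m) (toℚᵘ-/ b m))
  (ℚᵘP.≃-trans same-denominator (ℚᵘP.≃-sym (toℚᵘ-/ (a + b) m)))))
  where
  same-denominator : (+ a) ℚᵘ./ m ℚᵘ.+ (+ b) ℚᵘ./ m ≃ (+ (a + b)) ℚᵘ./ m
  same-denominator = *≡* (trans (distrib (+ a) (+ b) (+ m))
    (sym (cong₂ ℤ._*_ (ℤP.pos-+ a b) (ℤP.pos-* m m))))
    where
    distrib : ∀ x y z → (x ℤ.* z ℤ.+ y ℤ.* z) ℤ.* z ≡ (x ℤ.+ y) ℤ.* (z ℤ.* z)
    distrib = ℤSolver.solve-∀

/-<-positive : ∀ a m ε .{{_ : NonZero m}} .{{_ : Positive ε}} → a * ↧ₙ ε <ℕ m → (+ a) / m < ε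
/-<-positive a m@(suc _) (mkℚ +[1+ p ] d _) h =
  toℚᵘ-cancel-< (ℚᵘP.<-respˡ-≃ (ℚᵘP.≃-sym (toℚᵘ-/ a m))
    (*<* (subst₂ ℤ._<_ (ℤP.pos-* a (suc d)) (ℤP.pos-* (suc p) m) (ℤ.+<+ (<-≤-trans h (m≤m+n m (p * m)))))))

/-nonNeg : ∀ a m .{{_ : NonZero m}} → 0ℚ ℚ.≤ (+ a) / m
/-nonNeg a m = ℚP.nonNegative⁻¹ _ {{ℚP.normalize-nonNeg a m}}

telescope : ∀ (f g : ℕ → ℚ) → (∀ k → f k ℚ.+ g (suc k) ≡ g k) →
            ∀ k c → sumRange f k c ℚ.+ g (k + c) ≡ g k
telescope f g step k zero = trans (ℚP.+-identityˡ _) (cong g (+-identityʳ k))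
telescope f g step k (suc c) = begin
  (f k ℚ.+ sumRange f (suc k) c) ℚ.+ g (k + suc c) ≡⟨ cong (λ i → (f k ℚ.+ sumRange f (suc k) c) ℚ.+ g i) (+-suc k c) ⟩
  (f k ℚ.+ sumRange f (suc k) c) ℚ.+ g (suc k + c) ≡⟨ ℚP.+-assoc (f k) _ _ ⟩
  f k ℚ.+ (sumRange f (suc k) c ℚ.+ g (suc k + c)) ≡⟨ cong (f k ℚ.+_) (telescope f g step (suc k) c) ⟩
  f k ℚ.+ g (suc k)                                ≡⟨ step k ⟩
  g k                                              ∎
  where open ≡-Reasoning

distance-of-split : ∀ x y z → x ℚ.+ y ≡ z → 0ℚ ℚ.≤ y → ∣ x - z ∣ ≡ y
distance-of-split x y z x+y≡z 0≤y = trans (cong ∣_∣ x-z≡-y) (trans (ℚP.∣-p∣≡∣p∣ y) (ℚP.0≤p⇒∣p∣≡p 0≤y))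
  where
  open ≡-Reasoning
  x-z≡-y : x - z ≡ - y
  x-z≡-y = begin
    x ℚ.+ (- z)               ≡⟨ cong (λ w → x ℚ.+ (- w)) (sym x+y≡z) ⟩
    x ℚ.+ (- (x ℚ.+ y))       ≡⟨ cong (x ℚ.+_) (ℚP.neg-distrib-+ x y) ⟩
    x ℚ.+ ((- x) ℚ.+ (- y))   ≡⟨ sym (ℚP.+-assoc x (- x) (- y)) ⟩
    (x ℚ.+ (- x)) ℚ.+ (- y)   ≡⟨ cong (ℚ._+ (- y)) (ℚP.+-inverseʳ x) ⟩
    0ℚ ℚ.+ (- y)              ≡⟨ ℚP.+-identityˡ (- y) ⟩
    - y                       ∎

tail : ℕ → ℕ → ℚ
tail j k = (+ tailNum k j) / (2 ^ k)
  where instance _ = m^n≢0 2 k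

tail-step : ∀ j k → term j k ℚ.+ tail j (suc k) ≡ tail j k
tail-step j k = trans (/-+ (trinomial k j) (tailNum (suc k) j) (2 ^ suc k) {{m^n≢0 2 (suc k)}})
  (/-cross (trinomial k j + tailNum (suc k) j) (tailNum k j) (2 ^ suc k) (2 ^ k) {{m^n≢0 2 (suc k)}} {{m^n≢0 2 k}} cross)
  where
  open ≡-Reasoning
  cross : (trinomial k j + tailNum (suc k) j) * 2 ^ k ≡ tailNum k j * 2 ^ suc k
  cross = begin
    (trinomial k j + tailNum (suc k) j) * 2 ^ k ≡⟨ cong (_* 2 ^ k) (+-comm (trinomial k j) _) ⟩
    (tailNum (suc k) j + trinomial k j) * 2 ^ k ≡⟨ cong (_* 2 ^ k) (tailNum-step k j) ⟩
    2 * tailNum k j * 2 ^ k                     ≡⟨ cong (_* 2 ^ k) (*-comm 2 (tailNum k j)) ⟩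
    tailNum k j * 2 * 2 ^ k                     ≡⟨ *-assoc (tailNum k j) 2 (2 ^ k) ⟩
    tailNum k j * 2 ^ suc k                     ∎

tail-initial : ∀ j → tail j ⌈ j /2⌉ ≡ (+ fib (suc j)) / 1
tail-initial j = /-cross (tailNum L j) (fib (suc j)) (2 ^ L) 1 {{m^n≢0 2 L}} initial
  where
  L : ℕ
  L = ⌈ j /2⌉
  initial : tailNum L j * 1 ≡ fib (suc j) * 2 ^ L
  initial = trans (*-identityʳ _) (trans (tailNum-initial L j (double-half≤ (suc j))) (*-comm (2 ^ L) _))

corollary1 : (n : ℕ) → 1 ≤ n →
    (ε : ℚ) → 0ℚ < ε →
    ∃[ N ] ((c : ℕ) → N ≤ c →
      ∣ sumRange (term (n ∸ 1)) ⌈ (n ∸ 1) /2⌉ c - (+ fib n) / 1 ∣ < ε)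
corollary1 zero () ε 0<ε
corollary1 (suc j) _ ε 0<ε = 7 * (↧ₙ ε * tailBound j) , close
  where
  L : ℕ
  L = ⌈ j /2⌉
  -- The partial sum misses F (j+1) by exactly the tail from L + c on, and that tail
  -- is below ε once c ≥ 7 · den ε · tailBound j.
  close : (c : ℕ) → 7 * (↧ₙ ε * tailBound j) ≤ c →
          ∣ sumRange (term j) L c - (+ fib (suc j)) / 1 ∣ < ε
  close c h = subst (_< ε) (sym distance) tail<ε
    where
    m : ℕ
    m = L + c
    instance
      2^m≢0 : NonZero (2 ^ m)
      2^m≢0 = m^n≢0 2 m
      ε-positive : Positive ε
      ε-positive = positive 0<ε
    split : sumRange (term j) L c ℚ.+ tail j m ≡ (+ fib (suc j)) / 1
    split = trans (telescope (term j) (tail j) (tail-step j) L c) (tail-initial j)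
    distance : ∣ sumRange (term j) L c - (+ fib (suc j)) / 1 ∣ ≡ tail j m
    distance = distance-of-split (sumRange (term j) L c) (tail j m) ((+ fib (suc j)) / 1)
                                 split (/-nonNeg (tailNum m j) (2 ^ m))
    tail<ε : tail j m < ε
    tail<ε = /-<-positive (tailNum m j) (2 ^ m) ε
      (subst (_<ℕ 2 ^ m) (*-comm (↧ₙ ε) (tailNum m j)) (tailNum-small (↧ₙ ε) j m (≤-trans h (m≤n+m c L))))
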